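{- Let $k\geq 1$ and $x\in D_{2k}^0$. Then the sequence $\pi(x)$ is an alternating permutation of $\{1,2,\ldots,2k\}$. In particular, $f^k(x)=\overline{x}$.
   Context: A lattice path with $n$ steps is a sequence $x=(x_1,\ldots,x_n)$ of steps, each either an up-step $(1,1)$ or a down-step $(1,-1)$, drawn in $\mathbb{Z}^2$ starting at the origin; step $x_i$ (at position $i$) goes from $(i-1,h_{i-1})$ to $(i,h_i)$. A step lies below the line $y=c$ if both of its endpoints have $y$-coordinate at most $c$. A step touches the line $y=c$ if it starts or ends on that line. For $c\in\mathbb{Z}$, $u_c(x)$ and $d_c(x)$ denote the number of up-steps, respectively down-steps, of $x$ that start on the line $y=c$. Let $L_{2k,k}$ (resp. $L_{2k,k+1}$) be the set of lattice paths with $2k$ steps of which exactly $k$ (resp. $k+1$) are up-steps. $D_{2k}^e$ is the set of paths in $L_{2k,k}$ having exactly $e$ down-steps below the line $y=0$. For $x\in L_{2k,k}\setminus D_{2k}^k$, $g(x)$ is obtained from $x$ by replacing by an up-step the $(d_0(x)+1)$-th (from the left) down-step of $x$ touching the line $y=0$. For $x'\in L_{2k,k+1}$, $h(x')$ is obtained from $x'$ by replacing by a down-step the $u_1(x')$-th (from the left) up-step of $x'$ touching the line $y=1$. $f(x):=h(g(x))$, which maps $D_{2k}^e$ into $D_{2k}^{e+1}$ for $e<k$. For $\gamma\in\{g,h\}$, $\mathrm{pos}(\gamma,x)$ is the unique position where $x$ and $\gamma(x)$ differ. For $x\in D_{2k}^0$ set $x^0:=x$, $y^i:=g(x^i)$,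 $x^{i+1}:=h(y^i)$ for $i=0,\ldots,k-1$, and $\pi(x):=(\mathrm{pos}(g,x^0),\mathrm{pos}(h,y^0),\mathrm{pos}(g,x^1),\mathrm{pos}(h,y^1),\ldots,\mathrm{pos}(g,x^{k-1}),\mathrm{pos}(h,y^{k-1}))$. A sequence $(\alpha_1,\ldots,\alpha_{2k})$ is alternating if $\alpha_{i-1}>\alpha_i$ for all $i\in\{2,4,\ldots,2k\}$ and $\alpha_{i-1}<\alpha_i$ for all $i\in\{3,5,\ldots,2k-1\}$. For $x\in L_{2k,k}$, $\overline{x}$ is the path obtained by mirroring $x$ at the line $y=0$ (every up-step replaced by a down-step and vice versa). -}

module Defs where

open import Data.Bool using (Bool; true; false; if_then_else_; _∨_; _∧_)
open import Data.Nat as ℕ using (ℕ; zero; suc; _∸_; _<_)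
open import Data.Integer as ℤ using (ℤ; +_; _+_; _-_; _≤?_)
open import Data.List using (List; []; _∷_; length)
open import Data.Product using (_×_)
open import Data.Unit using (⊤)
open import Relation.Nullary using (does)
open import Relation.Binary.PropositionalEquality using (_≡_)
open import Function using (_∘_)

data Step : Set where
  U D : Step

-- A lattice path is the list of its steps (x₁,…,xₙ), starting at height 0.
Path : Set
Path = List Step

δ : Step → ℤ
δ U = + 1
δ D = ℤ.- (+ 1)

isU : Step → Bool
isU U = true
isU D = false

isD : Step → Bool
isD U = false
isD D = true

_==ℤ_ : ℤ → ℤ → Bool
a ==ℤ b = does (a ℤ.≟ b)

_==S_ : Step → Step → Bool
U ==S U = true
D ==S D = true
_ ==S _ = false

ups : Path → ℕ
ups [] = 0
ups (s ∷ xs) = if isU s then suc (ups xs) else ups xs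

downsBelow0From : ℤ → Path → ℕ
downsBelow0From h [] = 0
downsBelow0From h (U ∷ xs) = downsBelow0From (h + δ U) xs
downsBelow0From h (D ∷ xs) =
  if does (h ≤? + 0) ∧ does ((h + δ D) ≤? + 0)
  then suc (downsBelow0From (h + δ D) xs)
  else downsBelow0From (h + δ D) xs

downsBelow0 : Path → ℕ
downsBelow0 = downsBelow0From (+ 0)

startingOnFrom : Step → ℤ → ℤ → Path → ℕ
startingOnFrom s c h [] = 0
startingOnFrom s c h (t ∷ xs) =
  if (t ==S s) ∧ (h ==ℤ c)
  then suc (startingOnFrom s c (h + δ t) xs)
  else startingOnFrom s c (h + δ t) xs

u_ : ℤ → Path → ℕ
u_ c = startingOnFrom U c (+ 0)

d_ : ℤ → Path → ℕ
d_ c = startingOnFrom D c (+ 0)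

touches : ℤ → ℤ → Step → Bool
touches c h s = (h ==ℤ c) ∨ ((h + δ s) ==ℤ c)

-- Replace by `new` the (n+1)-th (from the left) step t of the path
-- (portion starting at height h) with t ≡ old and touching the line y = c.
-- (If there is no such step the path is returned unchanged.)
replaceFrom : Step → Step → ℤ → ℕ → ℤ → Path → Path
replaceFrom old new c n h [] = []
replaceFrom old new c n h (t ∷ xs) with (t ==S old) ∧ touches c h t
... | false = t ∷ replaceFrom old new c n (h + δ t) xs
... | true with n
...   | zero = new ∷ xs
...   | suc m = t ∷ replaceFrom old new c m (h + δ t) xs

g : Path → Path
g x = replaceFrom D U (+ 0) (d_ (+ 0) x) (+ 0) x

h : Path → Path
h x' = replaceFrom U D (+ 1) (u_ (+ 1) x' ∸ 1) (+ 0) x'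

f : Path → Path
f = h ∘ g

D[_,_] : ℕ → ℕ → Path → Set
D[ k , e ] x = (length x ≡ 2 ℕ.* k) × (ups x ≡ k) × (downsBelow0 x ≡ e)

-- first (1-indexed) position at which two paths differ (0 if none);
-- pos(γ, x) := diffPos x (γ x)
diffPos : Path → Path → ℕ
diffPos [] _ = 0
diffPos _ [] = 0
diffPos (s ∷ xs) (t ∷ ys) = if s ==S t then (if diffPos xs ys ℕ.≡ᵇ 0 then 0 else suc (diffPos xs ys)) else 1

pos : (Path → Path) → Path → ℕ
pos γ x = diffPos x (γ x)

πAux : ℕ → Path → List ℕ
πAux zero x = []
πAux (suc i) x = pos g x ∷ pos h (g x) ∷ πAux i (h (g x))

π : ℕ → Path → List ℕ
π k x = πAux k x

Alternating : List ℕ → Set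
Alternating [] = ⊤
Alternating (a ∷ []) = ⊤
Alternating (a ∷ b ∷ []) = b < a
Alternating (a ∷ b ∷ c ∷ rest) = (b < a) × (b < c) × Alternating (c ∷ rest)

flipStep : Step → Step
flipStep U = D
flipStep D = U

mirror : Path → Path
mirror [] = []
mirror (s ∷ xs) = flipStep s ∷ mirror xs

iter : ℕ → (Path → Path) → Path → Path
iter zero φ x = x
iter (suc n) φ x = φ (iter n φ x)

module Submission where

-- A nonempty Dyck path is U A D R with A, R Dyck paths. Started on the line y = 0 with g, the
-- alternating operations first treat the bump U A D by itself: g flips its final D, then the
-- operations act on the interior A exactly as on a Dyck path standing on the line y = 1 and
-- started with h, and a final h flips the initial U, leaving the mirror image of the bump; then R
-- is treated in the same way. Started on y = 1 with h the roles are exchanged: h flips the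
-- initial U, A is treated as from y = 0 with g, g flips the final D, and R comes before the bump.
-- Inductively every step is flipped exactly once, and the positions of a bump, 2 + |A|, then
-- 1 + (those of A), then 1 (resp. 1, 1 + (those of A), 2 + |A|), interleave in the zigzag
-- pattern. Everything rests on locality: g and h act on the middle of P ++ y ++ Q as on y alone
-- as long as P and Q balance the counts d₀ and u₁.

open import Defs
open import Data.Nat using (ℕ; suc; _≤_; _*_)
open import Data.List using (List; map; upTo)
open import Data.List.Relation.Binary.Permutation.Propositional using (_↭_)
open import Data.Product using (_×_)
open import Relation.Binary.PropositionalEquality using (_≡_)

open import Data.Bool using (Bool; true; false; not; if_then_else_; _∧_)
open import Data.Integer as ℤ using (ℤ; +_; -[1+_])
import Data.Integer.Properties as ℤ
open import Data.List using ([]; _∷_; _++_; length; applyUpTo)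
open import Data.List.Relation.Unary.All using (All; []; _∷_)
import Data.List.Relation.Unary.All as All
import Data.List.Relation.Unary.All.Properties as All
open import Data.List.Relation.Binary.Permutation.Propositional
  using (prep; ↭-refl; ↭-sym; ↭-trans; ↭-reflexive)
import Data.List.Relation.Binary.Permutation.Propositional.Properties as ↭
import Data.List.Properties as List
open import Data.Nat as ℕ using (zero; _+_; _∸_; _<_; z≤n; s≤s)
import Data.Nat.Properties as ℕ
open import Data.Product using (_,_; proj₁; proj₂)
open import Data.Unit using (⊤; tt)
open import Relation.Binary.PropositionalEquality
  using (refl; sym; trans; cong; subst; subst₂; module ≡-Reasoning)
open import Relation.Nullary using (yes; no)
open import Relation.Nullary.Decidable using (dec-true; dec-false)

-- Counting, replacing and comparing steps
touchingFrom : Step → ℤ → ℤ → Path → ℕ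
touchingFrom s c z [] = 0
touchingFrom s c z (t ∷ xs) =
  if (t ==S s) ∧ touches c z t
  then suc (touchingFrom s c (z ℤ.+ δ t) xs)
  else touchingFrom s c (z ℤ.+ δ t) xs

endHeight : ℤ → Path → ℤ
endHeight z [] = z
endHeight z (t ∷ xs) = endHeight (z ℤ.+ δ t) xs

endHeight-++ : ∀ z P Q → endHeight z (P ++ Q) ≡ endHeight (endHeight z P) Q
endHeight-++ z []      Q = refl
endHeight-++ z (t ∷ P) Q = endHeight-++ (z ℤ.+ δ t) P Q

startingOnFrom-++ : ∀ s c z P Q →
  startingOnFrom s c z (P ++ Q) ≡ startingOnFrom s c z P + startingOnFrom s c (endHeight z P) Q
startingOnFrom-++ s c z []      Q = refl
startingOnFrom-++ s c z (t ∷ P) Q with (t ==S s) ∧ (z ==ℤ c)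
... | true  = cong suc (startingOnFrom-++ s c (z ℤ.+ δ t) P Q)
... | false = startingOnFrom-++ s c (z ℤ.+ δ t) P Q

touchingFrom-++ : ∀ s c z P Q →
  touchingFrom s c z (P ++ Q) ≡ touchingFrom s c z P + touchingFrom s c (endHeight z P) Q
touchingFrom-++ s c z []      Q = refl
touchingFrom-++ s c z (t ∷ P) Q with (t ==S s) ∧ touches c z t
... | true  = cong suc (touchingFrom-++ s c (z ℤ.+ δ t) P Q)
... | false = touchingFrom-++ s c (z ℤ.+ δ t) P Q

replaceFrom-++ˡ : ∀ o new c n z P Q → n < touchingFrom o c z P →
  replaceFrom o new c n z (P ++ Q) ≡ replaceFrom o new c n z P ++ Q
replaceFrom-++ˡ o new c n z (t ∷ P) Q n<k with (t ==S o) ∧ touches c z t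
... | false = cong (t ∷_) (replaceFrom-++ˡ o new c n (z ℤ.+ δ t) P Q n<k)
replaceFrom-++ˡ o new c zero    z (t ∷ P) Q n<k       | true = refl
replaceFrom-++ˡ o new c (suc n) z (t ∷ P) Q (s≤s n<k) | true =
  cong (t ∷_) (replaceFrom-++ˡ o new c n (z ℤ.+ δ t) P Q n<k)

replaceFrom-++ʳ : ∀ o new c n z P Q →
  replaceFrom o new c (touchingFrom o c z P + n) z (P ++ Q) ≡ P ++ replaceFrom o new c n (endHeight z P) Q
replaceFrom-++ʳ o new c n z []      Q = refl
replaceFrom-++ʳ o new c n z (t ∷ P) Q with (t ==S o) ∧ touches c z t
... | false = cong (t ∷_) (replaceFrom-++ʳ o new c n (z ℤ.+ δ t) P Q)
... | true  = cong (t ∷_) (replaceFrom-++ʳ o new c n (z ℤ.+ δ t) P Q)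

replaceFrom-middle : ∀ o new c n z P y Q → n < touchingFrom o c (endHeight z P) y →
  replaceFrom o new c (touchingFrom o c z P + n) z (P ++ y ++ Q)
    ≡ P ++ replaceFrom o new c n (endHeight z P) y ++ Q
replaceFrom-middle o new c n z P y Q n<k =
  trans (replaceFrom-++ʳ o new c n z P (y ++ Q))
        (cong (P ++_) (replaceFrom-++ˡ o new c n (endHeight z P) y Q n<k))

length-replaceFrom : ∀ o new c n z y → length (replaceFrom o new c n z y) ≡ length y
length-replaceFrom o new c n z [] = refl
length-replaceFrom o new c n z (t ∷ y) with (t ==S o) ∧ touches c z t
... | false = cong suc (length-replaceFrom o new c n (z ℤ.+ δ t) y)
length-replaceFrom o new c zero    z (t ∷ y) | true = refl
length-replaceFrom o new c (suc n) z (t ∷ y) | true = cong suc (length-replaceFrom o new c n (z ℤ.+ δ t) y)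

==S-refl : ∀ s → (s ==S s) ≡ true
==S-refl U = refl
==S-refl D = refl

diffPos-refl : ∀ x → diffPos x x ≡ 0
diffPos-refl []      = refl
diffPos-refl (s ∷ x) rewrite ==S-refl s | diffPos-refl x = refl

diffPos-++ʳ : ∀ y y' Q → length y ≡ length y' → diffPos (y ++ Q) (y' ++ Q) ≡ diffPos y y'
diffPos-++ʳ []      []       Q _  = diffPos-refl Q
diffPos-++ʳ (s ∷ y) (t ∷ y') Q eq rewrite diffPos-++ʳ y y' Q (ℕ.suc-injective eq) = refl

diffPos-++ˡ : ∀ P y y' → 0 < diffPos y y' → diffPos (P ++ y) (P ++ y') ≡ length P + diffPos y y'
diffPos-++ˡ []      y y' _ = refl
diffPos-++ˡ (s ∷ P) y y' pos>0 rewrite ==S-refl s | diffPos-++ˡ P y y' pos>0 with diffPos y y' | pos>0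
... | suc d | _ rewrite ℕ.+-suc (length P) d = refl

diffPos-replaceFrom : ∀ o c n z y → n < touchingFrom o c z y → 0 < diffPos y (replaceFrom o (flipStep o) c n z y)
diffPos-replaceFrom o c n z (t ∷ y) n<k with (t ==S o) ∧ touches c z t in hit
... | false rewrite ==S-refl t
  with diffPos y (replaceFrom o (flipStep o) c n (z ℤ.+ δ t) y) | diffPos-replaceFrom o c n (z ℤ.+ δ t) y n<k
...   | suc _ | _ = s≤s z≤n
diffPos-replaceFrom o c zero z (t ∷ y) n<k | true = flipped t o hit
  where
  flipped : ∀ t o {b} → (t ==S o) ∧ b ≡ true → 0 < diffPos (t ∷ y) (flipStep o ∷ y)
  flipped U U _ = s≤s z≤n
  flipped D D _ = s≤s z≤n
diffPos-replaceFrom o c (suc n) z (t ∷ y) (s≤s n<k) | true rewrite ==S-refl t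
  with diffPos y (replaceFrom o (flipStep o) c n (z ℤ.+ δ t) y) | diffPos-replaceFrom o c n (z ℤ.+ δ t) y n<k
...   | suc _ | _ = s≤s z≤n

-- Heights and Dyck paths
up-down : ∀ z → z ℤ.+ δ U ℤ.+ δ D ≡ z
up-down z = trans (ℤ.+-assoc z (δ U) (δ D)) (ℤ.+-identityʳ z)

z<z+δU : ∀ z → z ℤ.< z ℤ.+ δ U
z<z+δU z = subst (ℤ._< z ℤ.+ δ U) (ℤ.+-identityʳ z) (ℤ.+-monoʳ-< z (ℤ.+<+ (s≤s z≤n)))

0<1 : + 0 ℤ.< + 1
0<1 = ℤ.+<+ (s≤s z≤n)

1<2 : + 1 ℤ.< + 2
1<2 = ℤ.+<+ (s≤s (s≤s z≤n))

-1<0 : -[1+ 0 ] ℤ.< + 0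
-1<0 = ℤ.-<+

==ℤ-refl : ∀ a → (a ==ℤ a) ≡ true
==ℤ-refl a = dec-true (a ℤ.≟ a) refl

<⇒==ℤ-false : ∀ {c a} → c ℤ.< a → (a ==ℤ c) ≡ false
<⇒==ℤ-false {c} {a} c<a = dec-false (a ℤ.≟ c) (λ a≡c → ℤ.<⇒≢ c<a (sym a≡c))

data Dyck : Path → Set where
  []   : Dyck []
  bump : ∀ {A R} → Dyck A → Dyck R → Dyck (U ∷ A ++ D ∷ R)

endHeight-Dyck : ∀ {x} → Dyck x → ∀ z → endHeight z x ≡ z
endHeight-Dyck []                 z = refl
endHeight-Dyck (bump {A} {R} a r) z
  rewrite endHeight-++ (z ℤ.+ δ U) A (D ∷ R) | endHeight-Dyck a (z ℤ.+ δ U) | up-down z = endHeight-Dyck r z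

startingOnFrom-D-Dyck : ∀ {x} → Dyck x → ∀ {c} z → c ℤ.≤ z → startingOnFrom D c z x ≡ 0
startingOnFrom-D-Dyck []                 z c≤z = refl
startingOnFrom-D-Dyck (bump {A} {R} a r) {c} z c≤z
  rewrite startingOnFrom-++ D c (z ℤ.+ δ U) A (D ∷ R)
        | startingOnFrom-D-Dyck a (z ℤ.+ δ U) (ℤ.<⇒≤ (ℤ.≤-<-trans c≤z (z<z+δU z)))
        | endHeight-Dyck a (z ℤ.+ δ U)
        | <⇒==ℤ-false (ℤ.≤-<-trans c≤z (z<z+δU z)) | up-down z = startingOnFrom-D-Dyck r z c≤z

touchingFrom-D-Dyck : ∀ {x} → Dyck x → ∀ {c} z → c ℤ.< z → touchingFrom D c z x ≡ 0
touchingFrom-D-Dyck []                 z c<z = refl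
touchingFrom-D-Dyck (bump {A} {R} a r) {c} z c<z
  rewrite touchingFrom-++ D c (z ℤ.+ δ U) A (D ∷ R)
        | touchingFrom-D-Dyck a (z ℤ.+ δ U) (ℤ.<-trans c<z (z<z+δU z))
        | endHeight-Dyck a (z ℤ.+ δ U)
        | <⇒==ℤ-false (ℤ.<-trans c<z (z<z+δU z)) | up-down z | <⇒==ℤ-false c<z = touchingFrom-D-Dyck r z c<z

startingOnFrom-U-Dyck : ∀ {x} → Dyck x → ∀ {c} z → c ℤ.< z → startingOnFrom U c z x ≡ 0
startingOnFrom-U-Dyck []                 z c<z = refl
startingOnFrom-U-Dyck (bump {A} {R} a r) {c} z c<z
  rewrite <⇒==ℤ-false c<z
        | startingOnFrom-++ U c (z ℤ.+ δ U) A (D ∷ R)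
        | startingOnFrom-U-Dyck a (z ℤ.+ δ U) (ℤ.<-trans c<z (z<z+δU z))
        | endHeight-Dyck a (z ℤ.+ δ U) | up-down z = startingOnFrom-U-Dyck r z c<z

touchingFrom-U-Dyck : ∀ {x} → Dyck x → ∀ {c} z → c ℤ.< z → touchingFrom U c z x ≡ 0
touchingFrom-U-Dyck []                 z c<z = refl
touchingFrom-U-Dyck (bump {A} {R} a r) {c} z c<z
  rewrite <⇒==ℤ-false c<z | <⇒==ℤ-false (ℤ.<-trans c<z (z<z+δU z))
        | touchingFrom-++ U c (z ℤ.+ δ U) A (D ∷ R)
        | touchingFrom-U-Dyck a (z ℤ.+ δ U) (ℤ.<-trans c<z (z<z+δU z))
        | endHeight-Dyck a (z ℤ.+ δ U) | up-down z = touchingFrom-U-Dyck r z c<z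

touchingFrom-U-base : ∀ {x} → Dyck x → ∀ z → touchingFrom U z z x ≡ startingOnFrom U z z x
touchingFrom-U-base []                 z = refl
touchingFrom-U-base (bump {A} {R} a r) z
  rewrite ==ℤ-refl z
        | touchingFrom-++ U z (z ℤ.+ δ U) A (D ∷ R) | startingOnFrom-++ U z (z ℤ.+ δ U) A (D ∷ R)
        | touchingFrom-U-Dyck a (z ℤ.+ δ U) (z<z+δU z) | startingOnFrom-U-Dyck a (z ℤ.+ δ U) (z<z+δU z)
        | endHeight-Dyck a (z ℤ.+ δ U) | up-down z = cong suc (touchingFrom-U-base r z)

-- Mirror images
mirror-++ : ∀ x y → mirror (x ++ y) ≡ mirror x ++ mirror y
mirror-++ []      y = refl
mirror-++ (t ∷ x) y = cong (flipStep t ∷_) (mirror-++ x y)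

length-mirror : ∀ x → length (mirror x) ≡ length x
length-mirror []      = refl
length-mirror (t ∷ x) = cong suc (length-mirror x)

==S-flipStep : ∀ t s → (flipStep t ==S s) ≡ (t ==S flipStep s)
==S-flipStep U U = refl
==S-flipStep U D = refl
==S-flipStep D U = refl
==S-flipStep D D = refl

==ℤ-neg : ∀ a c → ((ℤ.- a) ==ℤ (ℤ.- c)) ≡ (a ==ℤ c)
==ℤ-neg a c with a ℤ.≟ c
... | yes a≡c = dec-true  (ℤ.- a ℤ.≟ ℤ.- c) (cong ℤ.-_ a≡c)
... | no  a≢c = dec-false (ℤ.- a ℤ.≟ ℤ.- c) (λ e → a≢c (ℤ.neg-injective e))

neg-+-flipStep : ∀ z t → ℤ.- (z ℤ.+ δ (flipStep t)) ≡ ℤ.- z ℤ.+ δ t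
neg-+-flipStep z U = ℤ.neg-distrib-+ z (δ D)
neg-+-flipStep z D = ℤ.neg-distrib-+ z (δ U)

startingOnFrom-mirror : ∀ s c z x →
  startingOnFrom s c z (mirror x) ≡ startingOnFrom (flipStep s) (ℤ.- c) (ℤ.- z) x
startingOnFrom-mirror s c z []      = refl
startingOnFrom-mirror s c z (t ∷ x)
  rewrite startingOnFrom-mirror s c (z ℤ.+ δ (flipStep t)) x | neg-+-flipStep z t | ==S-flipStep t s
        | ==ℤ-neg z c = refl

touches-flipStep : ∀ c z t → touches c z (flipStep t) ≡ touches (ℤ.- c) (ℤ.- z) t
touches-flipStep c z t rewrite sym (neg-+-flipStep z t) | ==ℤ-neg (z ℤ.+ δ (flipStep t)) c | ==ℤ-neg z c = refl

touchingFrom-mirror : ∀ s c z x → touchingFrom s c z (mirror x) ≡ touchingFrom (flipStep s) (ℤ.- c) (ℤ.- z) x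
touchingFrom-mirror s c z []      = refl
touchingFrom-mirror s c z (t ∷ x)
  rewrite touchingFrom-mirror s c (z ℤ.+ δ (flipStep t)) x | touches-flipStep c z t | neg-+-flipStep z t
        | ==S-flipStep t s = refl

endHeight-mirror : ∀ z x → endHeight (ℤ.- z) (mirror x) ≡ ℤ.- endHeight z x
endHeight-mirror z []      = refl
endHeight-mirror z (U ∷ x) rewrite sym (neg-+-flipStep z D) = endHeight-mirror (z ℤ.+ δ U) x
endHeight-mirror z (D ∷ x) rewrite sym (neg-+-flipStep z U) = endHeight-mirror (z ℤ.+ δ D) x

endHeight-mirror-Dyck : ∀ {x} → Dyck x → ∀ z → endHeight z (mirror x) ≡ z
endHeight-mirror-Dyck {x} d z = begin
  endHeight z (mirror x)               ≡⟨ cong (λ w → endHeight w (mirror x)) (sym (ℤ.neg-involutive z)) ⟩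
  endHeight (ℤ.- (ℤ.- z)) (mirror x)   ≡⟨ endHeight-mirror (ℤ.- z) x ⟩
  ℤ.- endHeight (ℤ.- z) x              ≡⟨ cong ℤ.-_ (endHeight-Dyck d (ℤ.- z)) ⟩
  ℤ.- (ℤ.- z)                          ≡⟨ ℤ.neg-involutive z ⟩
  z                                    ∎
  where open ≡-Reasoning

-- The operations g and h on a segment
-- act true s and act false s are g and h applied to a path portion starting at height s.
act : Bool → ℤ → Path → Path
act true  s x = replaceFrom D U (+ 0) (startingOnFrom D (+ 0) s x) s x
act false s x = replaceFrom U D (+ 1) (startingOnFrom U (+ 1) s x ∸ 1) s x

-- The step to be replaced exists; for h also u₁ ≥ 1, so that the truncated u₁ ∸ 1 is the intended index.
Hits : Bool → ℤ → Path → Set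
Hits true  s y = startingOnFrom D (+ 0) s y < touchingFrom D (+ 0) s y
Hits false s y = 1 ≤ startingOnFrom U (+ 1) s y × startingOnFrom U (+ 1) s y ∸ 1 < touchingFrom U (+ 1) s y

Good : ℤ → ℤ → Bool → ℤ → Path → Set
Good zG zH b s y = Hits b s y × endHeight s y ≡ (if b then zG else zH)

length-act : ∀ b s y → length (act b s y) ≡ length y
length-act true  s y = length-replaceFrom D U (+ 0) _ s y
length-act false s y = length-replaceFrom U D (+ 1) _ s y

diffPos-act : ∀ b s y → Hits b s y → 0 < diffPos y (act b s y)
diffPos-act true  s y hit       = diffPos-replaceFrom D (+ 0) _ s y hit
diffPos-act false s y (_ , hit) = diffPos-replaceFrom U (+ 1) _ s y hit

-- Trace zG zH s b b' x z ps: applying g and h alternately, starting with g if b = true, to the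
-- portion x starting at height s yields z; ps are the positions changed, each operation changes
-- a step, the portion ends at height zG before each g and zH before each h, and b' is the next
-- operation due.
data Trace (zG zH s : ℤ) : Bool → Bool → Path → Path → List ℕ → Set where
  []   : ∀ {b x} → Trace zG zH s b b x x []
  step : ∀ {b b' x y z p ps} → Good zG zH b s x → act b s x ≡ y → diffPos x y ≡ p →
         Trace zG zH s (not b) b' y z ps → Trace zG zH s b b' x z (p ∷ ps)

_++ᵗ_ : ∀ {zG zH s b b' b'' x y z ps qs} → Trace zG zH s b b' x y ps → Trace zG zH s b' b'' y z qs →
        Trace zG zH s b b'' x z (ps ++ qs)
[]               ++ᵗ u = u
step good e e' t ++ᵗ u = step good e e' (t ++ᵗ u)

-- In P ++ y ++ Q the index d₀ used by g is d₀(P) + d₀(y) + d₀(Q); it picks the (d₀(y)+1)-th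
-- down-step of y touching y = 0 exactly when P has d₀(P) + d₀(Q) down-steps touching y = 0.
-- Likewise for h.
Isolates : Path → ℤ → ℤ → ℤ → Path → Set
Isolates P s zG zH Q =
  (touchingFrom D (+ 0) s P ≡ startingOnFrom D (+ 0) s P + startingOnFrom D (+ 0) zG Q) ×
  (touchingFrom U (+ 1) s P ≡ startingOnFrom U (+ 1) s P + startingOnFrom U (+ 1) zH Q)

startingOnFrom-++-++ : ∀ o c s P y Q {z} → endHeight (endHeight s P) y ≡ z →
  startingOnFrom o c s (P ++ y ++ Q)
    ≡ startingOnFrom o c s P + (startingOnFrom o c (endHeight s P) y + startingOnFrom o c z Q)
startingOnFrom-++-++ o c s P y Q refl
  rewrite startingOnFrom-++ o c s P (y ++ Q) | startingOnFrom-++ o c (endHeight s P) y Q = refl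

touchingFrom-++-++ : ∀ o c s P y Q →
  touchingFrom o c s (P ++ y ++ Q)
    ≡ touchingFrom o c s P + (touchingFrom o c (endHeight s P) y + touchingFrom o c (endHeight (endHeight s P) y) Q)
touchingFrom-++-++ o c s P y Q
  rewrite touchingFrom-++ o c s P (y ++ Q) | touchingFrom-++ o c (endHeight s P) y Q = refl

act-embed-G : ∀ P y Q {s zG zH} → Isolates P s zG zH Q → Good zG zH true (endHeight s P) y →
  (act true s (P ++ y ++ Q) ≡ P ++ act true (endHeight s P) y ++ Q) × Hits true s (P ++ y ++ Q)
act-embed-G P y Q {s} {zG} (isolated , _) (hit , end) = embedded , hits
  where
  open ≡-Reasoning
  sP sy sQ : ℕ
  sP = startingOnFrom D (+ 0) s P
  sy = startingOnFrom D (+ 0) (endHeight s P) y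
  sQ = startingOnFrom D (+ 0) zG Q
  index : startingOnFrom D (+ 0) s (P ++ y ++ Q) ≡ touchingFrom D (+ 0) s P + sy
  index = begin
    startingOnFrom D (+ 0) s (P ++ y ++ Q)  ≡⟨ startingOnFrom-++-++ D (+ 0) s P y Q end ⟩
    sP + (sy + sQ)                          ≡⟨ cong (λ n → sP + n) (ℕ.+-comm sy sQ) ⟩
    sP + (sQ + sy)                          ≡⟨ sym (ℕ.+-assoc sP sQ sy) ⟩
    sP + sQ + sy                            ≡⟨ cong (_+ sy) (sym isolated) ⟩
    touchingFrom D (+ 0) s P + sy           ∎
  embedded : act true s (P ++ y ++ Q) ≡ P ++ act true (endHeight s P) y ++ Q
  embedded rewrite index = replaceFrom-middle D U (+ 0) sy s P y Q hit
  hits : Hits true s (P ++ y ++ Q)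
  hits rewrite index | touchingFrom-++-++ D (+ 0) s P y Q = ℕ.+-monoʳ-< _ (ℕ.<-≤-trans hit (ℕ.m≤m+n _ _))

act-embed-H : ∀ P y Q {s zG zH} → Isolates P s zG zH Q → Good zG zH false (endHeight s P) y →
  (act false s (P ++ y ++ Q) ≡ P ++ act false (endHeight s P) y ++ Q) × Hits false s (P ++ y ++ Q)
act-embed-H P y Q {s} {zH = zH} (_ , isolated) ((1≤sy , hit) , end) = embedded , (1≤total , hits)
  where
  open ≡-Reasoning
  sP sy sQ : ℕ
  sP = startingOnFrom U (+ 1) s P
  sy = startingOnFrom U (+ 1) (endHeight s P) y
  sQ = startingOnFrom U (+ 1) zH Q
  total : startingOnFrom U (+ 1) s (P ++ y ++ Q) ≡ sP + (sy + sQ)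
  total = startingOnFrom-++-++ U (+ 1) s P y Q end
  1≤total : 1 ≤ startingOnFrom U (+ 1) s (P ++ y ++ Q)
  1≤total rewrite total = ℕ.≤-trans 1≤sy (ℕ.≤-trans (ℕ.m≤m+n sy sQ) (ℕ.m≤n+m _ sP))
  index : startingOnFrom U (+ 1) s (P ++ y ++ Q) ∸ 1 ≡ touchingFrom U (+ 1) s P + (sy ∸ 1)
  index = begin
    startingOnFrom U (+ 1) s (P ++ y ++ Q) ∸ 1  ≡⟨ cong (_∸ 1) total ⟩
    sP + (sy + sQ) ∸ 1                          ≡⟨ cong (λ n → sP + n ∸ 1) (ℕ.+-comm sy sQ) ⟩
    sP + (sQ + sy) ∸ 1                          ≡⟨ cong (_∸ 1) (sym (ℕ.+-assoc sP sQ sy)) ⟩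
    sP + sQ + sy ∸ 1                            ≡⟨ ℕ.+-∸-assoc (sP + sQ) 1≤sy ⟩
    sP + sQ + (sy ∸ 1)                          ≡⟨ cong (_+ (sy ∸ 1)) (sym isolated) ⟩
    touchingFrom U (+ 1) s P + (sy ∸ 1)         ∎
  embedded : act false s (P ++ y ++ Q) ≡ P ++ act false (endHeight s P) y ++ Q
  embedded rewrite index = replaceFrom-middle U D (+ 1) (sy ∸ 1) s P y Q hit
  hits : startingOnFrom U (+ 1) s (P ++ y ++ Q) ∸ 1 < touchingFrom U (+ 1) s (P ++ y ++ Q)
  hits rewrite index | touchingFrom-++-++ U (+ 1) s P y Q = ℕ.+-monoʳ-< _ (ℕ.<-≤-trans hit (ℕ.m≤m+n _ _))

act-embed : ∀ b P y Q {s zG zH} → Isolates P s zG zH Q → Good zG zH b (endHeight s P) y →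
  (act b s (P ++ y ++ Q) ≡ P ++ act b (endHeight s P) y ++ Q) × Hits b s (P ++ y ++ Q)
act-embed true  = act-embed-G
act-embed false = act-embed-H

endHeight-if : ∀ b zG zH Q → endHeight (if b then zG else zH) Q ≡ (if b then endHeight zG Q else endHeight zH Q)
endHeight-if true  zG zH Q = refl
endHeight-if false zG zH Q = refl

diffPos-embed : ∀ P y y' Q → length y ≡ length y' → 0 < diffPos y y' →
  diffPos (P ++ y ++ Q) (P ++ y' ++ Q) ≡ length P + diffPos y y'
diffPos-embed P y y' Q same-length changed =
  trans (diffPos-++ˡ P (y ++ Q) (y' ++ Q) (subst (0 <_) (sym suffix) changed)) (cong (λ n → length P + n) suffix)
  where
  suffix : diffPos (y ++ Q) (y' ++ Q) ≡ diffPos y y'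
  suffix = diffPos-++ʳ y y' Q same-length

trace-embed : ∀ P Q {s₀ s₁ zG zH zG' zH' b b' y y' ps} →
  endHeight s₀ P ≡ s₁ → endHeight zG Q ≡ zG' → endHeight zH Q ≡ zH' → Isolates P s₀ zG zH Q →
  Trace zG zH s₁ b b' y y' ps → Trace zG' zH' s₀ b b' (P ++ y ++ Q) (P ++ y' ++ Q) (map (λ n → length P + n) ps)
trace-embed P Q refl refl refl isolated [] = []
trace-embed P Q {s₀} {zG = zG} {zH} refl refl refl isolated (step {b} {x = x} good refl refl t) =
  step (proj₂ embedded , end) (proj₁ embedded)
       (diffPos-embed P x (act b _ x) Q (sym (length-act b _ x)) (diffPos-act b _ x (proj₁ good)))
       (trace-embed P Q refl refl refl isolated t)
  where
  embedded : (act b s₀ (P ++ x ++ Q) ≡ P ++ act b (endHeight s₀ P) x ++ Q) × Hits b s₀ (P ++ x ++ Q)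
  embedded = act-embed b P x Q isolated good
  end : endHeight s₀ (P ++ x ++ Q) ≡ (if b then endHeight zG Q else endHeight zH Q)
  end rewrite endHeight-++ s₀ P (x ++ Q) | endHeight-++ (endHeight s₀ P) x Q | proj₂ good =
    endHeight-if b zG zH Q

trace-embedˡ : ∀ Q {s zG zH b b' y y' ps} → endHeight zG Q ≡ zG → endHeight zH Q ≡ zH →
  startingOnFrom D (+ 0) zG Q ≡ 0 → startingOnFrom U (+ 1) zH Q ≡ 0 → Trace zG zH s b b' y y' ps →
  Trace zG zH s b b' (y ++ Q) (y' ++ Q) ps
trace-embedˡ Q {ps = ps} endG endH noG noH t =
  subst (Trace _ _ _ _ _ _ _) (List.map-id ps) (trace-embed [] Q refl endG endH (sym noG , sym noH) t)

trace-embedʳ : ∀ P {s₀ s₁ zG zH b b' y y' ps} → endHeight s₀ P ≡ s₁ →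
  touchingFrom D (+ 0) s₀ P ≡ startingOnFrom D (+ 0) s₀ P →
  touchingFrom U (+ 1) s₀ P ≡ startingOnFrom U (+ 1) s₀ P →
  Trace zG zH s₁ b b' y y' ps → Trace zG zH s₀ b b' (P ++ y) (P ++ y') (map (λ n → length P + n) ps)
trace-embedʳ P {y = y} {y'} e touchG touchH t =
  subst₂ (λ u v → Trace _ _ _ _ _ u v _) (cong (P ++_) (List.++-identityʳ y)) (cong (P ++_) (List.++-identityʳ y'))
    (trace-embed P [] e refl refl (trans touchG (sym (ℕ.+-identityʳ _)) , trans touchH (sym (ℕ.+-identityʳ _))) t)

-- Zigzag sequences
Order : Bool → ℕ → ℕ → Set
Order true  a b = b < a
Order false a b = a < b

Heads : Bool → ℕ → List ℕ → Set
Heads d a []      = ⊤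
Heads d a (b ∷ _) = Order d a b

-- Zigzag d d' l: the entries of l carry alternating labels starting with d, each entry is
-- followed by a smaller one if its label is true and by a larger one if it is false, and d' is the
-- label that would come next.
data Zigzag : Bool → Bool → List ℕ → Set where
  []   : ∀ {d} → Zigzag d d []
  cons : ∀ {d d' a l} → Heads d a l → Zigzag (not d) d' l → Zigzag d d' (a ∷ l)

heads-all : ∀ {d a l} → All (Order d a) l → Heads d a l
heads-all []      = tt
heads-all (o ∷ _) = o

zigzag-++ : ∀ {d d' d'' l₁ l₂} → Zigzag d d' l₁ → Zigzag d' d'' l₂ →
  All (λ a → All (Order (not d') a) l₂) l₁ → Zigzag d d'' (l₁ ++ l₂)
zigzag-++ []         z₂ []              = z₂
zigzag-++ (cons h z) z₂ (across ∷ rest) = cons (junction h z across) (zigzag-++ z z₂ rest)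
  where
  junction : ∀ {d d' a l l₂} → Heads d a l → Zigzag (not d) d' l → All (Order (not d') a) l₂ →
             Heads d a (l ++ l₂)
  junction {l = _ ∷ _}      h _  _      = h
  junction {true}  {l = []} _ [] across = heads-all across
  junction {false} {l = []} _ [] across = heads-all across

order-+ : ∀ d k {a b} → Order d a b → Order d (k + a) (k + b)
order-+ true  k o = ℕ.+-monoʳ-< k o
order-+ false k o = ℕ.+-monoʳ-< k o

zigzag-map-+ : ∀ k {d d' l} → Zigzag d d' l → Zigzag d d' (map (λ n → k + n) l)
zigzag-map-+ k []                         = []
zigzag-map-+ k (cons {l = []} h z)        = cons tt (zigzag-map-+ k z)
zigzag-map-+ k (cons {d} {l = _ ∷ _} h z) = cons (order-+ d k h) (zigzag-map-+ k z)

zigzag⇒alternating : ∀ {d l} → Zigzag true d l → Alternating l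
zigzag⇒alternating []                                 = tt
zigzag⇒alternating (cons _ [])                        = tt
zigzag⇒alternating (cons a>b (cons _ []))             = a>b
zigzag⇒alternating (cons a>b (cons b<c z@(cons _ _))) = a>b , b<c , zigzag⇒alternating z

segment : ℕ → ℕ → List ℕ
segment m zero    = []
segment m (suc n) = suc m ∷ segment (suc m) n

segment-++ : ∀ m a b → segment m (a + b) ≡ segment m a ++ segment (m + a) b
segment-++ m zero    b rewrite ℕ.+-identityʳ m = refl
segment-++ m (suc a) b rewrite ℕ.+-suc m a     = cong (suc m ∷_) (segment-++ (suc m) a b)

segment-suc : ∀ m n → segment m (suc n) ≡ segment m n ++ suc (m + n) ∷ []
segment-suc m n = trans (cong (segment m) (ℕ.+-comm 1 n)) (segment-++ m n 1)

map-segment : ∀ k m n → map (λ p → k + p) (segment m n) ≡ segment (k + m) n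
map-segment k m zero    = refl
map-segment k m (suc n) rewrite sym (ℕ.+-suc k m) = cong (k + suc m ∷_) (map-segment k (suc m) n)

applyUpTo-segment : ∀ (f : ℕ → ℕ) m n → (∀ i → f i ≡ m + i) → map suc (applyUpTo f n) ≡ segment m n
applyUpTo-segment f m zero    _ = refl
applyUpTo-segment f m (suc n) f≗m+ rewrite f≗m+ 0 | ℕ.+-identityʳ m =
  cong (suc m ∷_) (applyUpTo-segment (λ i → f (suc i)) (suc m) n (λ i → trans (f≗m+ (suc i)) (ℕ.+-suc m i)))

segment-bounds : ∀ m n → All (λ p → m < p × p ≤ m + n) (segment m n)
segment-bounds m zero    = []
segment-bounds m (suc n) rewrite ℕ.+-suc m n =
  (ℕ.n<1+n m , s≤s (ℕ.m≤m+n m n))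
  ∷ All.map (λ (m<p , p≤) → ℕ.<-trans (ℕ.n<1+n m) m<p , p≤) (segment-bounds (suc m) n)

length-segment : ∀ m n → length (segment m n) ≡ n
length-segment m zero    = refl
length-segment m (suc n) = cong suc (length-segment (suc m) n)

upTo-segment : ∀ n → map suc (upTo n) ≡ segment 0 n
upTo-segment n = applyUpTo-segment (λ i → i) 0 n (λ _ → refl)

bounded : ∀ {q n} → q ↭ segment 0 n → All (λ p → 0 < p × p ≤ n) q
bounded {n = n} q↭ = ↭.All-resp-↭ (↭-sym q↭) (segment-bounds 0 n)

shift-↭ : ∀ k {q n} → q ↭ segment 0 n → map (λ p → k + p) q ↭ segment k n
shift-↭ k {n = n} q↭ =
  ↭-trans (↭.map⁺ _ q↭)
          (↭-reflexive (trans (map-segment k 0 n) (cong (λ m → segment m n) (ℕ.+-identityʳ k))))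

bump-↭ : ∀ a {q} → q ↭ segment 0 a → 1 ∷ map suc q ++ 2 + a ∷ [] ↭ segment 0 (2 + a)
bump-↭ a q↭ = prep 1 (↭-trans (↭.++⁺ʳ (2 + a ∷ []) (shift-↭ 1 q↭)) (↭-reflexive (sym (segment-suc 1 a))))

bump-↭-swapped : ∀ a {q} → q ↭ segment 0 a → 2 + a ∷ map suc q ++ 1 ∷ [] ↭ segment 0 (2 + a)
bump-↭-swapped a {q} q↭ = ↭-trans swap-ends (bump-↭ a q↭)
  where
  L : List ℕ
  L = map suc q
  swap-ends : 2 + a ∷ L ++ 1 ∷ [] ↭ 1 ∷ L ++ 2 + a ∷ []
  swap-ends = ↭-trans (↭.∷↭∷ʳ (2 + a) (L ++ 1 ∷ []))
                (↭-trans (↭-reflexive (List.++-assoc L (1 ∷ []) (2 + a ∷ []))) (↭.shift 1 L (2 + a ∷ [])))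

++-↭ : ∀ e r {p q} → p ↭ segment 0 e → q ↭ segment 0 r → p ++ map (λ n → e + n) q ↭ segment 0 (e + r)
++-↭ e r p↭ q↭ = ↭-trans (↭.++⁺ p↭ (shift-↭ e q↭)) (↭-reflexive (sym (segment-++ 0 e r)))

++-↭-swapped : ∀ e r {p q} → p ↭ segment 0 e → q ↭ segment 0 r →
  map (λ n → e + n) q ++ p ↭ segment 0 (e + r)
++-↭-swapped e r {p} {q} p↭ q↭ = ↭-trans (↭.++-comm (map (λ n → e + n) q) p) (++-↭ e r p↭ q↭)

zigzag-bump-H : ∀ a {q} → Zigzag true true q → q ↭ segment 0 a →
  Zigzag false false (1 ∷ map suc q ++ 2 + a ∷ [])
zigzag-bump-H a {q} zq q↭ =
  cons (heads-all (All.++⁺ (All.map⁺ (All.map (λ (0<p , _) → s≤s 0<p) inside)) (s≤s (s≤s z≤n) ∷ [])))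
       (zigzag-++ (zigzag-map-+ 1 zq) (cons tt [])
                  (All.map⁺ (All.map (λ (_ , p≤a) → s≤s (s≤s p≤a) ∷ []) inside)))
  where
  inside : All (λ p → 0 < p × p ≤ a) q
  inside = bounded q↭

zigzag-bump-G : ∀ a {q} → Zigzag false false q → q ↭ segment 0 a →
  Zigzag true true (2 + a ∷ map suc q ++ 1 ∷ [])
zigzag-bump-G a {q} zq q↭ =
  cons (heads-all (All.++⁺ (All.map⁺ (All.map (λ (_ , p≤a) → s≤s (s≤s p≤a)) inside)) (s≤s (s≤s z≤n) ∷ [])))
       (zigzag-++ (zigzag-map-+ 1 zq) (cons tt [])
                  (All.map⁺ (All.map (λ (0<p , _) → s≤s 0<p ∷ []) inside)))
  where
  inside : All (λ p → 0 < p × p ≤ a) q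
  inside = bounded q↭

zigzag-++-G : ∀ e {p q r} → Zigzag true true p → p ↭ segment 0 e → Zigzag true true q → q ↭ segment 0 r →
  Zigzag true true (p ++ map (λ n → e + n) q)
zigzag-++-G e zp p↭ zq q↭ =
  zigzag-++ zp (zigzag-map-+ e zq)
    (All.map (λ (_ , a≤e) → All.map⁺ (All.map (λ (0<b , _) → ℕ.≤-<-trans a≤e (ℕ.m<m+n e 0<b)) (bounded q↭)))
             (bounded p↭))

zigzag-++-H : ∀ e {p q r} → Zigzag false false p → p ↭ segment 0 e → Zigzag false false q → q ↭ segment 0 r →
  Zigzag false false (map (λ n → e + n) q ++ p)
zigzag-++-H e zp p↭ zq q↭ =
  zigzag-++ (zigzag-map-+ e zq) zp
    (All.map⁺ (All.map (λ (0<a , _) → All.map (λ (_ , b≤e) → ℕ.≤-<-trans b≤e (ℕ.m<m+n e 0<a)) (bounded p↭))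
                       (bounded q↭)))

-- Sweeping Dyck paths
touchingFrom-D-mirror-base : ∀ {x} → Dyck x → ∀ z →
  touchingFrom D z z (mirror x) ≡ startingOnFrom D z z (mirror x)
touchingFrom-D-mirror-base {x} d z =
  trans (touchingFrom-mirror D z z x) (trans (touchingFrom-U-base d (ℤ.- z)) (sym (startingOnFrom-mirror D z z x)))

diffPos-last : ∀ P → diffPos (P ++ D ∷ []) (P ++ U ∷ []) ≡ suc (length P)
diffPos-last P = trans (diffPos-++ˡ P (D ∷ []) (U ∷ []) (s≤s z≤n)) (ℕ.+-comm (length P) 1)

module _ {A : Path} (a : Dyck A) where

  touchingFrom-D-bump : touchingFrom D (+ 0) (+ 0) (U ∷ A ++ D ∷ []) ≡ 1
  touchingFrom-D-bump rewrite touchingFrom-++ D (+ 0) (+ 1) A (D ∷ []) | touchingFrom-D-Dyck a (+ 1) 0<1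
                        | endHeight-Dyck a (+ 1) = refl

  good-G-first : Good (+ 0) (+ 2) true (+ 0) (U ∷ A ++ D ∷ [])
  good-G-first rewrite startingOnFrom-D-Dyck (bump a []) (+ 0) ℤ.≤-refl | touchingFrom-D-bump =
    s≤s z≤n , endHeight-Dyck (bump a []) (+ 0)

  act-G-first : act true (+ 0) (U ∷ A ++ D ∷ []) ≡ U ∷ A ++ U ∷ []
  act-G-first rewrite startingOnFrom-D-Dyck (bump a []) (+ 0) ℤ.≤-refl = cong (U ∷_) (begin
      replaceFrom D U (+ 0) 0 (+ 1) (A ++ D ∷ [])
        ≡⟨ cong (λ n → replaceFrom D U (+ 0) n (+ 1) (A ++ D ∷ []))
                (sym (trans (ℕ.+-identityʳ _) (touchingFrom-D-Dyck a (+ 1) 0<1))) ⟩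
      replaceFrom D U (+ 0) (touchingFrom D (+ 0) (+ 1) A + 0) (+ 1) (A ++ D ∷ [])
        ≡⟨ replaceFrom-++ʳ D U (+ 0) 0 (+ 1) A (D ∷ []) ⟩
      A ++ replaceFrom D U (+ 0) 0 (endHeight (+ 1) A) (D ∷ [])
        ≡⟨ cong (λ z → A ++ replaceFrom D U (+ 0) 0 z (D ∷ [])) (endHeight-Dyck a (+ 1)) ⟩
      A ++ U ∷ [] ∎)
    where open ≡-Reasoning

  startingOnFrom-U-mirror : startingOnFrom U (+ 1) (+ 1) (mirror A) ≡ 0
  startingOnFrom-U-mirror = trans (startingOnFrom-mirror U (+ 1) (+ 1) A) (startingOnFrom-D-Dyck a -[1+ 0 ] ℤ.≤-refl)

  good-H-last : Good (+ 0) (+ 2) false (+ 0) (U ∷ mirror A ++ U ∷ [])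
  good-H-last
    rewrite startingOnFrom-++ U (+ 1) (+ 1) (mirror A) (U ∷ []) | startingOnFrom-U-mirror
          | endHeight-++ (+ 1) (mirror A) (U ∷ []) | endHeight-mirror-Dyck a (+ 1) = (s≤s z≤n , s≤s z≤n) , refl

  act-H-last : act false (+ 0) (U ∷ mirror A ++ U ∷ []) ≡ D ∷ mirror A ++ U ∷ []
  act-H-last rewrite startingOnFrom-++ U (+ 1) (+ 1) (mirror A) (U ∷ []) | startingOnFrom-U-mirror
                   | endHeight-mirror-Dyck a (+ 1) = refl

  good-H-first : Good -[1+ 0 ] (+ 1) false (+ 1) (U ∷ A ++ D ∷ [])
  good-H-first rewrite startingOnFrom-++ U (+ 1) (+ 2) A (D ∷ []) | startingOnFrom-U-Dyck a (+ 2) 1<2 =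
    (s≤s z≤n , s≤s z≤n) , endHeight-Dyck (bump a []) (+ 1)

  act-H-first : act false (+ 1) (U ∷ A ++ D ∷ []) ≡ D ∷ A ++ D ∷ []
  act-H-first rewrite startingOnFrom-++ U (+ 1) (+ 2) A (D ∷ []) | startingOnFrom-U-Dyck a (+ 2) 1<2 = refl

  good-G-last : Good -[1+ 0 ] (+ 1) true (+ 1) (D ∷ mirror A ++ D ∷ [])
  good-G-last
    rewrite startingOnFrom-++ D (+ 0) (+ 0) (mirror A) (D ∷ []) | touchingFrom-++ D (+ 0) (+ 0) (mirror A) (D ∷ [])
          | endHeight-++ (+ 0) (mirror A) (D ∷ []) | endHeight-mirror-Dyck a (+ 0)
          | touchingFrom-D-mirror-base a (+ 0) = s≤s (ℕ.≤-refl) , refl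

  act-G-last : act true (+ 1) (D ∷ mirror A ++ D ∷ []) ≡ D ∷ mirror A ++ U ∷ []
  act-G-last = begin
      replaceFrom D U (+ 0) (startingOnFrom D (+ 0) (+ 0) (mirror A ++ D ∷ [])) (+ 1) (D ∷ mirror A ++ D ∷ [])
        ≡⟨ cong (λ n → replaceFrom D U (+ 0) n (+ 1) (D ∷ mirror A ++ D ∷ [])) index ⟩
      D ∷ replaceFrom D U (+ 0) (touchingFrom D (+ 0) (+ 0) (mirror A) + 0) (+ 0) (mirror A ++ D ∷ [])
        ≡⟨ cong (D ∷_) (replaceFrom-++ʳ D U (+ 0) 0 (+ 0) (mirror A) (D ∷ [])) ⟩
      D ∷ mirror A ++ replaceFrom D U (+ 0) 0 (endHeight (+ 0) (mirror A)) (D ∷ [])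
        ≡⟨ cong (λ z → D ∷ mirror A ++ replaceFrom D U (+ 0) 0 z (D ∷ [])) (endHeight-mirror-Dyck a (+ 0)) ⟩
      D ∷ mirror A ++ U ∷ [] ∎
    where
    open ≡-Reasoning
    index : startingOnFrom D (+ 0) (+ 0) (mirror A ++ D ∷ []) ≡ suc (touchingFrom D (+ 0) (+ 0) (mirror A) + 0)
    index rewrite startingOnFrom-++ D (+ 0) (+ 0) (mirror A) (D ∷ []) | endHeight-mirror-Dyck a (+ 0)
                | touchingFrom-D-mirror-base a (+ 0) = trans (ℕ.+-comm _ 1) (cong suc (sym (ℕ.+-identityʳ _)))

mirror-bump : ∀ A → mirror (U ∷ A ++ D ∷ []) ≡ D ∷ mirror A ++ U ∷ []
mirror-bump A = cong (D ∷_) (mirror-++ A (D ∷ []))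

trace-bump-G : ∀ {A q} → Dyck A → Trace -[1+ 0 ] (+ 1) (+ 1) false false A (mirror A) q →
  Trace (+ 0) (+ 2) (+ 0) true true (U ∷ A ++ D ∷ []) (mirror (U ∷ A ++ D ∷ []))
        (2 + length A ∷ map suc q ++ 1 ∷ [])
trace-bump-G {A} a t rewrite mirror-bump A =
  step (good-G-first a) (act-G-first a) (diffPos-last (U ∷ A))
    (trace-embed (U ∷ []) (U ∷ []) refl refl refl (refl , refl) t ++ᵗ step (good-H-last a) (act-H-last a) refl [])

trace-bump-H : ∀ {A q} → Dyck A → Trace (+ 0) (+ 2) (+ 0) true true A (mirror A) q →
  Trace -[1+ 0 ] (+ 1) (+ 1) false false (U ∷ A ++ D ∷ []) (mirror (U ∷ A ++ D ∷ []))
        (1 ∷ map suc q ++ 2 + length A ∷ [])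
trace-bump-H {A} a t rewrite mirror-bump A =
  step (good-H-first a) (act-H-first a) refl
    (trace-embed (D ∷ []) (D ∷ []) refl refl refl (refl , refl) t ++ᵗ
     step (good-G-last a) (act-G-last a)
          (trans (diffPos-last (D ∷ mirror A)) (cong (λ n → 2 + n) (length-mirror A))) [])

trace-++-G : ∀ {E R p q} → Dyck E → Dyck R →
  Trace (+ 0) (+ 2) (+ 0) true true E (mirror E) p → Trace (+ 0) (+ 2) (+ 0) true true R (mirror R) q →
  Trace (+ 0) (+ 2) (+ 0) true true (E ++ R) (mirror (E ++ R)) (p ++ map (λ n → length E + n) q)
trace-++-G {E} {R} {q = q} e r tE tR rewrite mirror-++ E R =
  trace-embedˡ R (endHeight-Dyck r (+ 0)) (endHeight-Dyck r (+ 2))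
    (startingOnFrom-D-Dyck r (+ 0) ℤ.≤-refl) (startingOnFrom-U-Dyck r (+ 2) 1<2) tE
  ++ᵗ subst (λ n → Trace (+ 0) (+ 2) (+ 0) true true (mirror E ++ R) (mirror E ++ mirror R) (map (λ m → n + m) q))
          (length-mirror E)
        (trace-embedʳ (mirror E) (endHeight-mirror-Dyck e (+ 0)) (touchingFrom-D-mirror-base e (+ 0)) noH tR)
  where
  noH : touchingFrom U (+ 1) (+ 0) (mirror E) ≡ startingOnFrom U (+ 1) (+ 0) (mirror E)
  noH = trans (trans (touchingFrom-mirror U (+ 1) (+ 0) E) (touchingFrom-D-Dyck e (+ 0) -1<0))
              (sym (trans (startingOnFrom-mirror U (+ 1) (+ 0) E) (startingOnFrom-D-Dyck e (+ 0) (ℤ.<⇒≤ -1<0))))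

trace-++-H : ∀ {E R p q} → Dyck E → Dyck R →
  Trace -[1+ 0 ] (+ 1) (+ 1) false false E (mirror E) p → Trace -[1+ 0 ] (+ 1) (+ 1) false false R (mirror R) q →
  Trace -[1+ 0 ] (+ 1) (+ 1) false false (E ++ R) (mirror (E ++ R)) (map (λ n → length E + n) q ++ p)
trace-++-H {E} {R} e r tE tR rewrite mirror-++ E R =
  trace-embedʳ E (endHeight-Dyck e (+ 1)) noG (touchingFrom-U-base e (+ 1)) tR
  ++ᵗ trace-embedˡ (mirror R) (endHeight-mirror-Dyck r -[1+ 0 ]) (endHeight-mirror-Dyck r (+ 1))
        (trans (startingOnFrom-mirror D (+ 0) -[1+ 0 ] R) (startingOnFrom-U-Dyck r (+ 1) 0<1))
        (startingOnFrom-U-mirror r) tE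
  where
  noG : touchingFrom D (+ 0) (+ 1) E ≡ startingOnFrom D (+ 0) (+ 1) E
  noG = trans (touchingFrom-D-Dyck e (+ 1) 0<1) (sym (startingOnFrom-D-Dyck e (+ 1) (ℤ.<⇒≤ 0<1)))

record Sweep (b : Bool) (s zG zH : ℤ) (x : Path) : Set where
  constructor sweep
  field
    positions : List ℕ
    trace     : Trace zG zH s b b x (mirror x) positions
    zigzag    : Zigzag b b positions
    permutes  : positions ↭ segment 0 (length x)

-- A Dyck path standing on the line y = 0 and started with g, resp. standing on y = 1 and started with h.
SweepG SweepH : Path → Set
SweepG = Sweep true (+ 0) (+ 0) (+ 2)
SweepH = Sweep false (+ 1) -[1+ 0 ] (+ 1)

length-bump : ∀ A → length (U ∷ A ++ D ∷ []) ≡ 2 + length A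
length-bump A = cong suc (trans (List.length-++ A) (ℕ.+-comm (length A) 1))

resize : ∀ {l m n} → m ≡ n → l ↭ segment 0 m → l ↭ segment 0 n
resize refl l↭ = l↭

sweep-bump-G : ∀ {A} → Dyck A → SweepH A → SweepG (U ∷ A ++ D ∷ [])
sweep-bump-G {A} a (sweep q t zq q↭) =
  sweep _ (trace-bump-G a t) (zigzag-bump-G (length A) zq q↭)
    (resize (sym (length-bump A)) (bump-↭-swapped (length A) q↭))

sweep-bump-H : ∀ {A} → Dyck A → SweepG A → SweepH (U ∷ A ++ D ∷ [])
sweep-bump-H {A} a (sweep q t zq q↭) =
  sweep _ (trace-bump-H a t) (zigzag-bump-H (length A) zq q↭)
    (resize (sym (length-bump A)) (bump-↭ (length A) q↭))

sweep-++-G : ∀ {E R} → Dyck E → Dyck R → SweepG E → SweepG R → SweepG (E ++ R)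
sweep-++-G {E} {R} e r (sweep p tE zp p↭) (sweep q tR zq q↭) =
  sweep _ (trace-++-G e r tE tR) (zigzag-++-G (length E) zp p↭ zq q↭)
    (resize (sym (List.length-++ E)) (++-↭ (length E) (length R) p↭ q↭))

sweep-++-H : ∀ {E R} → Dyck E → Dyck R → SweepH E → SweepH R → SweepH (E ++ R)
sweep-++-H {E} {R} e r (sweep p tE zp p↭) (sweep q tR zq q↭) =
  sweep _ (trace-++-H e r tE tR) (zigzag-++-H (length E) zp p↭ zq q↭)
    (resize (sym (List.length-++ E)) (++-↭-swapped (length E) (length R) p↭ q↭))

sweeps : ∀ {x} → Dyck x → SweepG x × SweepH x
sweeps [] = sweep [] [] [] ↭-refl , sweep [] [] [] ↭-refl
sweeps (bump {A} {R} a r) with sweeps a | sweeps r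
... | gA , hA | gR , hR =
  subst (λ x → SweepG x × SweepH x) (cong (U ∷_) (List.++-assoc A (D ∷ []) R))
    (sweep-++-G (bump a []) r (sweep-bump-G a hA) gR , sweep-++-H (bump a []) r (sweep-bump-H a gA) hR)

-- From D_{2k}^0 to Dyck paths

-- Descent n x: x = A₀ D A₁ D ⋯ D Aₙ with all Aᵢ Dyck paths, i.e. x ends n levels below its start
-- and never goes lower.
data Descent : ℕ → Path → Set where
  level : ∀ {A} → Dyck A → Descent 0 A
  down  : ∀ {n A R} → Dyck A → Descent n R → Descent (suc n) (A ++ D ∷ R)

bump-Descent : ∀ {n A R} → Dyck A → Descent n R → Descent n (U ∷ A ++ D ∷ R)
bump-Descent a (level r) = level (bump a r)
bump-Descent {A = A} a (down {A = A'} {R'} a' t) =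
  subst (Descent _) (cong (U ∷_) (List.++-assoc A (D ∷ A') (D ∷ R'))) (down (bump a a') t)

+-2*-suc : ∀ n u → n + 2 * suc u ≡ suc (suc n + 2 * u)
+-2*-suc n u = begin
  n + 2 * suc u            ≡⟨ cong (λ m → n + m) (ℕ.*-suc 2 u) ⟩
  n + suc (suc (2 * u))    ≡⟨ ℕ.+-suc n (suc (2 * u)) ⟩
  suc (n + suc (2 * u))    ≡⟨ cong suc (ℕ.+-suc n (2 * u)) ⟩
  suc (suc (n + 2 * u))    ∎
  where open ≡-Reasoning

toDescent : ∀ n x → downsBelow0From (+ n) x ≡ 0 → length x ≡ n + 2 * ups x → Descent n x
toDescent zero    []      _ _ = level []
toDescent (suc n) []      _ ()
toDescent n       (U ∷ x) noneBelow len
  with toDescent (suc n) x (subst (λ m → downsBelow0From (+ m) x ≡ 0) (ℕ.+-comm n 1) noneBelow)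
                           (ℕ.suc-injective (trans len (+-2*-suc n (ups x))))
... | down a t = bump-Descent a t
toDescent (suc n) (D ∷ x) noneBelow len = down [] (toDescent n x noneBelow (ℕ.suc-injective len))

D₀⇒Dyck : ∀ k x → D[ k , 0 ] x → Dyck x
D₀⇒Dyck k x (len , ups≡k , noneBelow) with toDescent 0 x noneBelow (trans len (cong (2 *_) (sym ups≡k)))
... | level d = d

iter-suc : ∀ k x → iter (suc k) f x ≡ iter k f (f x)
iter-suc zero    x = refl
iter-suc (suc k) x = cong f (iter-suc k x)

trace⇒iter-π : ∀ k {zG zH x y ps} → Trace zG zH (+ 0) true true x y ps → length ps ≡ 2 * k →
  iter k f x ≡ y × π k x ≡ ps
trace⇒iter-π zero    []                    _   = refl , refl
trace⇒iter-π (suc k) {x = x} {y} (step _ refl refl (step {ps = ps} _ refl refl t)) len =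
  trans (iter-suc k x) (proj₁ rest) , cong (λ l → _ ∷ _ ∷ l) (proj₂ rest)
  where
  rest : iter k f (f x) ≡ y × π k (f x) ≡ ps
  rest = trace⇒iter-π k t (ℕ.suc-injective (ℕ.suc-injective (trans len (ℕ.*-suc 2 k))))

lemma12 : (k : ℕ) → 1 ≤ k → (x : Path) → D[ k , 0 ] x →
          (Alternating (π k x) × (π k x ↭ map suc (upTo (2 * k))))
          × iter k f x ≡ mirror x
lemma12 k _ x x∈D₀@(len , _) = (subst Alternating (sym π≡) (zigzag⇒alternating zigzag) , permutation) , iter≡
  where
  open Sweep (proj₁ (sweeps (D₀⇒Dyck k x x∈D₀)))
  outcome : iter k f x ≡ mirror x × π k x ≡ positions
  outcome = trace⇒iter-π k trace (trans (↭.↭-length permutes) (trans (length-segment 0 (length x)) len))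
  iter≡ : iter k f x ≡ mirror x
  iter≡ = proj₁ outcome
  π≡ : π k x ≡ positions
  π≡ = proj₂ outcome
  permutation : π k x ↭ map suc (upTo (2 * k))
  permutation rewrite π≡ | upTo-segment (2 * k) = resize len permutes
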